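{- Let $f_n=|\hat{\mathcal{B}}_n(213)|$. For $n\geq1$, \[f_n=1+\sum_{k=1}^{n-2}f_k\sum_{j=2}^{n-k}f_j.\]
   Context: An endofunction of size $n$ is a word $x=x_1\cdots x_n$ with entries in $\{1,\dots,n\}$; it is a Cayley permutation if it contains every integer between $1$ and $\max(x)$. Let $\mathrm{Ascbot}(x)=\{1\}\cup\{i:1\leq i\leq n-1,\ x_i<x_{i+1}\}$ and $\mathrm{Nub}(x)$ the set of indices $i$ such that $x_i$ is the leftmost occurrence of its value. A revised ascent sequence of length $n$ is a Cayley permutation $x$ of length $n$ with $\mathrm{Ascbot}(x)=\mathrm{Nub}(x)$. For Cayley permutations $x$ and $\sigma=\sigma_1\cdots\sigma_k$, $x$ contains $\sigma$ if there are indices $i_1<\cdots<i_k$ such that for all $s,t$: $x_{i_s}<x_{i_t}\iff\sigma_s<\sigma_t$ and $x_{i_s}=x_{i_t}\iff\sigma_s=\sigma_t$; otherwise $x$ avoids $\sigma$. $\hat{\mathcal{B}}_n(\sigma)$ is the set of revised ascent sequences of length $n$ avoiding $\sigma$. Empty sums are $0$. -}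

module Defs where

open import Data.Nat using (ℕ; zero; suc; _+_; _∸_; _<ᵇ_; _≡ᵇ_; _⊔_)
open import Data.Bool using (Bool; true; false; _∧_; _∨_; not)
open import Data.List using (List; []; _∷_; map; concatMap; filter; length; upTo; foldr)
open import Data.Bool.ListAction using (all; any)
open import Function using (_∘_)
open import Relation.Nullary.Decidable using (Dec; yes; no)

-- Words are lists of naturals; positions are 1-indexed.

range1 : ℕ → List ℕ
range1 m = map suc (upTo m)

wordsOver : ℕ → ℕ → List (List ℕ)
wordsOver zero    m = [] ∷ []
wordsOver (suc l) m = concatMap (λ w → map (_∷ w) (range1 m)) (wordsOver l m)

endofunctions : ℕ → List (List ℕ)
endofunctions n = wordsOver n n

-- x_i (1-indexed); value 0 outside the range 1..length x (never used there)
at : List ℕ → ℕ → ℕ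
at []      _             = 0
at (a ∷ x) zero          = 0
at (a ∷ x) (suc zero)    = a
at (a ∷ x) (suc (suc i)) = at x (suc i)

maxL : List ℕ → ℕ
maxL = foldr _⊔_ 0

elemᵇ : ℕ → List ℕ → Bool
elemᵇ v = any (v ≡ᵇ_)

isCayley : List ℕ → Bool
isCayley x = all (λ v → elemᵇ v x) (range1 (maxL x))

inAscbot : List ℕ → ℕ → Bool
inAscbot x i = (i ≡ᵇ 1) ∨ ((0 <ᵇ i) ∧ (i <ᵇ length x) ∧ (at x i <ᵇ at x (suc i)))

inNub : List ℕ → ℕ → Bool
inNub x i = (0 <ᵇ i) ∧ (i <ᵇ suc (length x))
          ∧ all (λ j → not (at x j ≡ᵇ at x i)) (range1 (i ∸ 1))

iffᵇ : Bool → Bool → Bool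
iffᵇ a b = (a ∧ b) ∨ (not a ∧ not b)

-- Ascbot(x) = Nub(x) as sets of indices; both are subsets of {1,...,max(n,1)}
sameAscbotNub : List ℕ → Bool
sameAscbotNub x = all (λ i → iffᵇ (inAscbot x i) (inNub x i)) (range1 (suc (length x)))

isRevisedAscent : List ℕ → Bool
isRevisedAscent x = isCayley x ∧ sameAscbotNub x

subseqs : List ℕ → List (List ℕ)
subseqs []      = [] ∷ []
subseqs (a ∷ x) = map (a ∷_) (subseqs x) Data.List.++ subseqs x

orderIso : List ℕ → List ℕ → Bool
orderIso y σ = (length y ≡ᵇ length σ)
  ∧ all (λ s → all (λ t →
        iffᵇ (at y s <ᵇ at y t) (at σ s <ᵇ at σ t)
      ∧ iffᵇ (at y s ≡ᵇ at y t) (at σ s ≡ᵇ at σ t))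
      (range1 (length σ))) (range1 (length σ))

contains : List ℕ → List ℕ → Bool
contains x σ = any (λ y → orderIso y σ) (subseqs x)

avoids : List ℕ → List ℕ → Bool
avoids x σ = not (contains x σ)

Bhat : ℕ → List ℕ → List (List ℕ)
Bhat n σ = filter (λ x → Data.Bool.T? (isRevisedAscent x ∧ avoids x σ)) (endofunctions n)

-- Σ_{i=a}^{b} g i  (empty sum = 0 when b < a)
sumFromTo : ℕ → ℕ → (ℕ → ℕ) → ℕ
sumFromTo a b g = foldr _+_ 0 (map (λ d → g (a + d)) (upTo (suc b ∸ a)))

pat213 : List ℕ
pat213 = 2 ∷ 1 ∷ 3 ∷ []

f : ℕ → ℕ
f n = length (Bhat n pat213)

{-# OPTIONS --safe #-}
-- A sequence in B̂ₙ(213) other than 1ⁿ factors uniquely as (P + q) 1 (Q′ + 1) 1ʳ with P ∈ B̂ₖ(213),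
-- q ∷ Q′ ∈ B̂ⱼ(213), k ≥ 1, j ≥ 2 and k + j + r = n.  Reading the sequence left to right, an entry
-- is new iff the next entry is larger.  So the first 1 is new and must ascend, while every later 1
-- is old and can only be followed by 1s; writing q + 1 for the least entry before the first 1,
-- avoiding 213 bounds all entries after the first 1 by q + 1, and the head q of a revised ascent
-- sequence is its maximum.  Conversely every such gluing lies in B̂ₙ(213), and counting the pairs
-- (P, Q) gives the recurrence.
module Submission where

open import Defs
open import Data.Nat using (ℕ; zero; suc; _+_; _*_; _∸_; _≤_; _<_; z≤n; s≤s; _<ᵇ_; _≡ᵇ_; _≟_; _≤?_; _<?_)
open import Data.Nat.Properties
open import Data.Bool using (Bool; true; false; _∧_; not; T; T?)
open import Data.Bool.Properties using (T-∧; T-≡; T-not-≡)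
open import Data.Bool.ListAction using (all; any)
open import Data.List using (List; []; _∷_; _++_; [_]; map; concatMap; length; upTo; foldr; replicate; cartesianProduct; reverseAcc)
open import Data.List.Properties using (map-injective; ∷-injective; ∷-injectiveʳ; ++-assoc; ++-identityʳ; length-map; length-++; length-++-sucʳ; map-++; length-replicate; map-cong)
open import Data.List.Membership.Propositional using (_∈_; _∉_; find; lose)
open import Data.List.Membership.Propositional.Properties using (∈-∃++; ∈-map⁺; ∈-map⁻; ∈-++⁺ˡ; ∈-++⁺ʳ; ∈-++⁻; ∈-concatMap⁺; ∈-concatMap⁻; ∈-upTo⁺; ∈-upTo⁻; ∈-cartesianProduct⁺; ∈-cartesianProduct⁻; ∈-filter⁺; ∈-filter⁻)
open import Data.List.Membership.DecPropositional _≟_ using (_∈?_)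
open import Data.List.Relation.Unary.Any as Any using (Any; here; there)
import Data.List.Relation.Unary.Any.Properties as Anyₚ
open import Data.List.Relation.Unary.All as All using (All; []; _∷_)
import Data.List.Relation.Unary.All.Properties as Allₚ
import Data.List.Relation.Unary.First as First
open import Data.List.Relation.Unary.First.Properties using (toView)
open import Data.List.Extrema.Nat using (min; min≤⊤; min≤xs; argmin-sel)
open import Data.List.Relation.Unary.AllPairs as AllPairs using (AllPairs)
import Data.List.Relation.Unary.AllPairs.Properties as AllPairsₚ
open import Data.List.Relation.Unary.Unique.Propositional using (Unique)
open import Data.List.Membership.Propositional.Properties.WithK using (unique∧set⇒bag)
open import Data.List.Relation.Binary.BagAndSetEquality using (∼bag⇒↭)
open import Data.List.Relation.Binary.Permutation.Propositional.Properties using (↭-length)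
import Data.List.Relation.Unary.Unique.Propositional.Properties as Uniqueₚ
open import Data.List.Relation.Binary.Sublist.Propositional using (_⊆_; []; _∷_; _∷ʳ_; to∈; from∈)
open import Data.Product using (∃; ∃₂; _×_; _,_; proj₁; proj₂)
open import Data.Sum as Sum using (_⊎_; inj₁; inj₂)
open import Data.Empty using (⊥)
open import Data.Unit using (⊤; tt)
open import Relation.Nullary using (¬_; yes; no; contradiction; decidable-stable)
import Relation.Nullary.Decidable as Dec
open import Relation.Binary.PropositionalEquality using (_≡_; _≢_; refl; sym; trans; cong; cong₂; subst; module ≡-Reasoning)
open import Function using (_∘_; id)
open import Function.Bundles using (Equivalence; _⇔_; mk⇔)
open import Function.Properties.Equivalence using (⇔-setoid)
open import Function.Construct.Symmetry using (⇔-sym)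
open import Level using (0ℓ)
import Relation.Binary.Reasoning.Setoid as SetoidReasoning
open import Data.Product.Function.NonDependent.Propositional using (_×-⇔_)

open Equivalence using (to; from)

T-<ᵇ : ∀ {m n} → T (m <ᵇ n) ⇔ m < n
T-<ᵇ {m} {n} = mk⇔ (<ᵇ⇒< m n) <⇒<ᵇ

T-≡ᵇ : ∀ {m n} → T (m ≡ᵇ n) ⇔ m ≡ n
T-≡ᵇ {m} {n} = mk⇔ (≡ᵇ⇒≡ m n) (≡⇒≡ᵇ m n)

T-not : ∀ {b} → T (not b) ⇔ (¬ T b)
T-not {true}  = mk⇔ (λ ()) (λ ¬t → ¬t tt)
T-not {false} = mk⇔ (λ _ ()) (λ _ → tt)

T-iffᵇ : ∀ {a b} → T (iffᵇ a b) ⇔ (T a ⇔ T b)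
T-iffᵇ {true}  {true}  = mk⇔ (λ _ → mk⇔ _ _) _
T-iffᵇ {true}  {false} = mk⇔ (λ ()) (λ e → to e tt)
T-iffᵇ {false} {true}  = mk⇔ (λ ()) (λ e → from e tt)
T-iffᵇ {false} {false} = mk⇔ (λ _ → mk⇔ (λ ()) (λ ())) _

∈-range1 : ∀ {v m} → v ∈ range1 m ⇔ (1 ≤ v × v ≤ m)
∈-range1 {v} {m} = mk⇔ out into
  where
  out : v ∈ range1 m → 1 ≤ v × v ≤ m
  out v∈ with ∈-map⁻ suc v∈
  ... | w , w∈ , refl = s≤s z≤n , ∈-upTo⁻ w∈
  into : 1 ≤ v × v ≤ m → v ∈ range1 m
  into (s≤s z≤n , v≤m) = ∈-map⁺ suc (∈-upTo⁺ v≤m)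

all-range1 : ∀ (p : ℕ → Bool) m → T (all p (range1 m)) ⇔ (∀ v → 1 ≤ v → v ≤ m → T (p v))
all-range1 p m = mk⇔
  (λ h v 1≤v v≤m → All.lookup (Allₚ.all⁺ p _ h) (from ∈-range1 (1≤v , v≤m)))
  (λ h → Allₚ.all⁻ p (All.tabulate λ v∈ → let 1≤v , v≤m = to ∈-range1 v∈ in h _ 1≤v v≤m))

T-elemᵇ : ∀ {v x} → T (elemᵇ v x) ⇔ v ∈ x
T-elemᵇ {v} {x} = mk⇔
  (λ h → Any.map (to T-≡ᵇ) (Anyₚ.any⁻ (v ≡ᵇ_) x h))
  (λ v∈ → Anyₚ.any⁺ (v ≡ᵇ_) (Any.map (from T-≡ᵇ) v∈))

≤-maxL : ∀ {v} x → v ∈ x → v ≤ maxL x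
≤-maxL (a ∷ x) (here refl) = m≤m⊔n a (maxL x)
≤-maxL (a ∷ x) (there v∈)  = ≤-trans (≤-maxL x v∈) (m≤n⊔m a (maxL x))

maxL-≤ : ∀ {B} x → All (_≤ B) x → maxL x ≤ B
maxL-≤ []      []         = z≤n
maxL-≤ (a ∷ x) (a≤ ∷ x≤) = ⊔-lub a≤ (maxL-≤ x x≤)

maxL-∈ : ∀ a x → maxL (a ∷ x) ∈ a ∷ x
maxL-∈ a [] rewrite ⊔-identityʳ a = here refl
maxL-∈ a (b ∷ x) with ⊔-sel a (maxL (b ∷ x))
... | inj₁ eq rewrite eq = here refl
... | inj₂ eq rewrite eq = there (maxL-∈ b x)

Cayley : List ℕ → Set
Cayley x = ∀ v → 1 ≤ v → v ≤ maxL x → v ∈ x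

T-isCayley : ∀ {x} → T (isCayley x) ⇔ Cayley x
T-isCayley {x} = mk⇔
  (λ h v 1≤v v≤max → to T-elemᵇ (to (all-range1 _ (maxL x)) h v 1≤v v≤max))
  (λ c → from (all-range1 _ (maxL x)) λ v 1≤v v≤max → from T-elemᵇ (c v 1≤v v≤max))

covers⇒≤length : ∀ m x → (∀ v → 1 ≤ v → v ≤ m → v ∈ x) → m ≤ length x
covers⇒≤length zero    x cov = z≤n
covers⇒≤length (suc m) x cov with ∈-∃++ (cov (suc m) (s≤s z≤n) ≤-refl)
... | u , w , refl = subst (suc m ≤_) (sym (length-++-sucʳ u (suc m) w))
                       (s≤s (covers⇒≤length m (u ++ w) cov′))
  where
  cov′ : ∀ v → 1 ≤ v → v ≤ m → v ∈ u ++ w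
  cov′ v 1≤v v≤m with ∈-++⁻ u (cov v 1≤v (m≤n⇒m≤1+n v≤m))
  ... | inj₁ v∈u         = ∈-++⁺ˡ v∈u
  ... | inj₂ (here refl) = contradiction v≤m (n≮n m)
  ... | inj₂ (there v∈w) = ∈-++⁺ʳ u v∈w

Cayley⇒maxL≤length : ∀ x → Cayley x → maxL x ≤ length x
Cayley⇒maxL≤length x = covers⇒≤length (maxL x) x

-- Revised ascent sequences, scanned from left to right

-- S holds the values seen so far (in reverse), so an entry a is new iff a ∉ S; next is what follows
-- the scanned part.
NewIffAscentAt : List ℕ → ℕ → List ℕ → Set
NewIffAscentAt S a []       = a ∈ S
NewIffAscentAt S a (b ∷ _)  = (a ∉ S → a < b) × (a < b → a ∉ S)

NewIffAscent : List ℕ → List ℕ → List ℕ → Set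
NewIffAscent S []      next = ⊤
NewIffAscent S (a ∷ y) next = NewIffAscentAt S a (y ++ next) × NewIffAscent (a ∷ S) y next

RevisedAscent : List ℕ → Set
RevisedAscent []      = ⊥
RevisedAscent (a ∷ y) = NewIffAscent [ a ] y []

NewAt : List ℕ → List ℕ → ℕ → Set
NewAt S y i = at y i ∉ S × (∀ j → 1 ≤ j → j < i → at y j ≢ at y i)

AscentAt : List ℕ → ℕ → Set
AscentAt y i = i < length y × at y i < at y (suc i)

NewAt-∷ : ∀ {S b y k} → NewAt S (b ∷ y) (suc (suc k)) ⇔ NewAt (b ∷ S) y (suc k)
NewAt-∷ {S} {b} {y} {k} = mk⇔ out into
  where
  out : NewAt S (b ∷ y) (suc (suc k)) → NewAt (b ∷ S) y (suc k)
  out (∉S , distinct) = ∉b∷S , λ { (suc j) _ j<k → distinct (suc (suc j)) (s≤s z≤n) (s≤s j<k) }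
    where
    ∉b∷S : at y (suc k) ∉ b ∷ S
    ∉b∷S (here eq)  = distinct 1 ≤-refl (s≤s (s≤s z≤n)) (sym eq)
    ∉b∷S (there ∈S) = ∉S ∈S
  into : NewAt (b ∷ S) y (suc k) → NewAt S (b ∷ y) (suc (suc k))
  into (∉b∷S , distinct) = ∉b∷S ∘ there , distinct′
    where
    distinct′ : ∀ j → 1 ≤ j → j < suc (suc k) → at (b ∷ y) j ≢ at y (suc k)
    distinct′ (suc zero)    _ _         eq = ∉b∷S (here (sym eq))
    distinct′ (suc (suc j)) _ (s≤s j<k) eq = distinct (suc j) (s≤s z≤n) j<k eq

NewIffAscentAtEach : List ℕ → List ℕ → Set
NewIffAscentAtEach S y = ∀ i → 1 ≤ i → i ≤ length y → NewAt S y i ⇔ AscentAt y i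

NewIffAscent⇔AtEach : ∀ S y → NewIffAscent S y [] ⇔ NewIffAscentAtEach S y
NewIffAscent⇔AtEach S y = mk⇔ (out S y) (into S y)
  where
  noEarlier : ∀ {y} j → 1 ≤ j → j < 1 → at y j ≢ at y 1
  noEarlier (suc j) _ (s≤s ())
  out : ∀ S y → NewIffAscent S y [] → NewIffAscentAtEach S y
  out S (b ∷ []) (old , _) 1 _ _ =
    mk⇔ (λ new → contradiction old (proj₁ new)) (λ asc → contradiction (proj₁ asc) (n≮n 1))
  out S (b ∷ c ∷ y) ((new⇒asc , asc⇒new) , _) 1 _ _ =
    mk⇔ (λ new → s≤s (s≤s z≤n) , new⇒asc (proj₁ new)) (λ asc → asc⇒new (proj₂ asc) , noEarlier {b ∷ c ∷ y})
  out S (b ∷ y) (_ , rest) (suc (suc k)) _ (s≤s k<) =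
    let e = out (b ∷ S) y rest (suc k) (s≤s z≤n) k< in
    mk⇔ (λ new → let k<y , asc = to e (to NewAt-∷ new) in s≤s k<y , asc)
        (λ asc → from NewAt-∷ (from e (≤-pred (proj₁ asc) , proj₂ asc)))
  dropFirst : ∀ {S b y} → NewIffAscentAtEach S (b ∷ y) → NewIffAscentAtEach (b ∷ S) y
  dropFirst h (suc k) _ k< =
    let e = h (suc (suc k)) (s≤s z≤n) (s≤s k<) in
    mk⇔ (λ new → let k<y , asc = to e (from NewAt-∷ new) in ≤-pred k<y , asc)
        (λ asc → to NewAt-∷ (from e (s≤s (proj₁ asc) , proj₂ asc)))
  into : ∀ S y → NewIffAscentAtEach S y → NewIffAscent S y []
  into S []          _ = tt
  into S (b ∷ [])    h =
    decidable-stable (b ∈? S) (λ ∉S → n≮n 1 (proj₁ (to (h 1 ≤-refl (s≤s z≤n)) (∉S , noEarlier {b ∷ []})))) , tt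
  into S (b ∷ c ∷ y) h =
    ((λ ∉S → proj₂ (to e (∉S , noEarlier {b ∷ c ∷ y}))) , (λ b<c → proj₁ (from e (s≤s (s≤s z≤n) , b<c)))) ,
    into (b ∷ S) (c ∷ y) (dropFirst h)
    where
    e = h 1 ≤-refl (s≤s z≤n)

inAscbot⇔AscentAt : ∀ {a y k} → T (inAscbot (a ∷ y) (suc (suc k))) ⇔ AscentAt y (suc k)
inAscbot⇔AscentAt = mk⇔
  (λ h → let p , q = to T-∧ h in to T-<ᵇ p , to T-<ᵇ q)
  (λ (p , q) → from T-∧ (from T-<ᵇ p , from T-<ᵇ q))

inNub⇔NewAt : ∀ {a y k} → T (inNub (a ∷ y) (suc (suc k))) ⇔ (k < length y × NewAt [ a ] y (suc k))
inNub⇔NewAt {a} {y} {k} = mk⇔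
  (λ h → let k< , old = to T-∧ h ; distinct = to (all-range1 _ (suc k)) old in
         to T-<ᵇ k< ,
         (λ { (here eq) → to T-not (distinct 1 ≤-refl (s≤s z≤n)) (from T-≡ᵇ (sym eq)) }) ,
         (λ { (suc j) _ j<k eq → to T-not (distinct (suc (suc j)) (s≤s z≤n) j<k) (from T-≡ᵇ eq) }))
  (λ (k< , ∉a , distinct) → from T-∧ (from T-<ᵇ k< , from (all-range1 _ (suc k)) λ where
      (suc zero)    _ _         → from T-not λ eq → ∉a (here (sym (to T-≡ᵇ eq)))
      (suc (suc j)) _ j<k       → from T-not λ eq → distinct (suc j) (s≤s z≤n) j<k (to T-≡ᵇ eq)))

T-sameAscbotNub : ∀ x → T (sameAscbotNub x) ⇔ RevisedAscent x
T-sameAscbotNub []      = mk⇔ (λ ()) (λ ())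
T-sameAscbotNub (a ∷ y) = mk⇔
  (λ h → from (NewIffAscent⇔AtEach [ a ] y) (out h))
  (λ r → into (to (NewIffAscent⇔AtEach [ a ] y) r))
  where
  Agree : ℕ → Set
  Agree i = T (inAscbot (a ∷ y) i) ⇔ T (inNub (a ∷ y) i)
  agreeᵇ : ℕ → Bool
  agreeᵇ i = iffᵇ (inAscbot (a ∷ y) i) (inNub (a ∷ y) i)
  asc⇔ : ∀ k → T (inAscbot (a ∷ y) (suc (suc k))) ⇔ AscentAt y (suc k)
  asc⇔ k = inAscbot⇔AscentAt {a} {y} {k}
  nub⇔ : ∀ k → T (inNub (a ∷ y) (suc (suc k))) ⇔ (k < length y × NewAt [ a ] y (suc k))
  nub⇔ k = inNub⇔NewAt {a} {y} {k}
  out : T (sameAscbotNub (a ∷ y)) → NewIffAscentAtEach [ a ] y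
  out h (suc k) _ k< =
    let e = to T-iffᵇ (to (all-range1 agreeᵇ (suc (suc (length y)))) h (suc (suc k)) (s≤s z≤n) (s≤s (m≤n⇒m≤1+n k<))) in
    mk⇔ (λ new → to (asc⇔ k) (from e (from (nub⇔ k) (k< , new))))
        (λ asc → proj₂ (to (nub⇔ k) (to e (from (asc⇔ k) asc))))
  agree : NewIffAscentAtEach [ a ] y → ∀ k → Agree (suc (suc k))
  agree p k with k <? length y
  ... | yes k< = mk⇔ (λ asc → from (nub⇔ k) (k< , from (p (suc k) (s≤s z≤n) k<) (to (asc⇔ k) asc)))
                     (λ new → from (asc⇔ k) (to (p (suc k) (s≤s z≤n) k<) (proj₂ (to (nub⇔ k) new))))
  ... | no k≮ = mk⇔ (λ asc → contradiction (<⇒≤ (proj₁ (to (asc⇔ k) asc))) k≮)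
                    (λ new → contradiction (proj₁ (to (nub⇔ k) new)) k≮)
  into : NewIffAscentAtEach [ a ] y → T (sameAscbotNub (a ∷ y))
  into p = from (all-range1 agreeᵇ (suc (suc (length y)))) λ where
    (suc zero)    _ _ → tt
    (suc (suc k)) _ _ → from T-iffᵇ (agree p k)

-- Avoiding 213

-- No occurrence of 213 in a ∷ y has a as its 2.
No213From : ℕ → List ℕ → Set
No213From a []      = ⊤
No213From a (b ∷ y) = (b < a → All (_≤ a) y) × No213From a y

Avoids213 : List ℕ → Set
Avoids213 []      = ⊤
Avoids213 (a ∷ y) = No213From a y × Avoids213 y

Contains213 : List ℕ → Set
Contains213 x = ∃₂ λ a b → ∃ λ c → (a ∷ b ∷ c ∷ []) ⊆ x × b < a × a < c

Avoids213⇔¬Contains213 : ∀ x → Avoids213 x ⇔ (¬ Contains213 x)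
Avoids213⇔¬Contains213 x = mk⇔ (λ av (a , b , c , s , b<a , a<c) → out x av s b<a a<c) (into x)
  where
  bounded : ∀ {a b c} x → No213From a x → (b ∷ c ∷ []) ⊆ x → b < a → c ≤ a
  bounded (d ∷ x) (_ , free) (_ ∷ʳ s)  b<a = bounded x free s b<a
  bounded (d ∷ x) (≤a , _)   (refl ∷ s) b<a = All.lookup (≤a b<a) (to∈ s)
  out : ∀ {a b c} x → Avoids213 x → (a ∷ b ∷ c ∷ []) ⊆ x → b < a → a < c → ⊥
  out (d ∷ x) (_ , av)   (_ ∷ʳ s)   b<a a<c = out x av s b<a a<c
  out (d ∷ x) (free , _) (refl ∷ s) b<a a<c = <⇒≱ a<c (bounded x free s b<a)
  into : ∀ x → ¬ Contains213 x → Avoids213 x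
  into []      _ = tt
  into (a ∷ x) ¬p = headFree x (λ b c s lt → ¬p (a , b , c , refl ∷ s , lt)) ,
                    into x (λ (a′ , b , c , s , lt) → ¬p (a′ , b , c , a ∷ʳ s , lt))
    where
    headFree : ∀ x → (∀ b c → (b ∷ c ∷ []) ⊆ x → ¬ (b < a × a < c)) → No213From a x
    headFree []      _  = tt
    headFree (b ∷ x) ¬q = (λ b<a → All.tabulate λ c∈ → ≮⇒≥ λ a<c → ¬q b _ (refl ∷ from∈ c∈) (b<a , a<c)) ,
                          headFree x (λ b′ c s → ¬q b′ c (b ∷ʳ s))

∈-subseqs : ∀ {y x} → y ∈ subseqs x ⇔ y ⊆ x
∈-subseqs = mk⇔ (out _) into
  where
  out : ∀ x {y} → y ∈ subseqs x → y ⊆ x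
  out []      (here refl) = []
  out (a ∷ x) y∈ with ∈-++⁻ (map (a ∷_) (subseqs x)) y∈
  ... | inj₂ y∈′ = a ∷ʳ out x y∈′
  ... | inj₁ y∈′ with ∈-map⁻ (a ∷_) y∈′
  ... | z , z∈ , refl = refl ∷ out x z∈
  into : ∀ {y x} → y ⊆ x → y ∈ subseqs x
  into []                     = here refl
  into {x = a ∷ x} (_ ∷ʳ s)   = ∈-++⁺ʳ (map (a ∷_) (subseqs x)) (into s)
  into {x = a ∷ x} (refl ∷ s) = ∈-++⁺ˡ (∈-map⁺ (a ∷_) (into s))

orderIso-< : ∀ y σ {s t} → T (orderIso y σ) → s ∈ range1 (length σ) → t ∈ range1 (length σ) →
  T (at σ s <ᵇ at σ t) → at y s < at y t
orderIso-< y σ {s} {t} iso s∈ t∈ σs<σt = to T-<ᵇ (from (to T-iffᵇ (proj₁ (to T-∧ cell))) σs<σt)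
  where
  cellᵇ : ℕ → ℕ → Bool
  cellᵇ s t = iffᵇ (at y s <ᵇ at y t) (at σ s <ᵇ at σ t) ∧ iffᵇ (at y s ≡ᵇ at y t) (at σ s ≡ᵇ at σ t)
  rows = Allₚ.all⁺ (λ s → all (cellᵇ s) (range1 (length σ))) _ (proj₂ (to T-∧ iso))
  cell = All.lookup (Allₚ.all⁺ (cellᵇ s) _ (All.lookup rows s∈)) t∈

orderIso-213⁻ : ∀ y → T (orderIso y pat213) → ∃₂ λ a b → ∃ λ c → y ≡ a ∷ b ∷ c ∷ [] × b < a × a < c
orderIso-213⁻ y@(a ∷ b ∷ c ∷ []) iso =
  a , b , c , refl ,
  orderIso-< y pat213 iso (there (here refl)) (here refl) tt ,
  orderIso-< y pat213 iso (here refl) (there (there (here refl))) tt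

<ᵇ-true : ∀ {m n} → m < n → (m <ᵇ n) ≡ true
<ᵇ-true = to T-≡ ∘ <⇒<ᵇ

<ᵇ-false : ∀ {m n} → ¬ m < n → (m <ᵇ n) ≡ false
<ᵇ-false {m} {n} m≮n = to T-not-≡ (from T-not (m≮n ∘ <ᵇ⇒< m n))

≡ᵇ-true : ∀ n → (n ≡ᵇ n) ≡ true
≡ᵇ-true n = to T-≡ (≡⇒≡ᵇ n n refl)

≡ᵇ-false : ∀ {m n} → m ≢ n → (m ≡ᵇ n) ≡ false
≡ᵇ-false {m} {n} m≢n = to T-not-≡ (from T-not (m≢n ∘ ≡ᵇ⇒≡ m n))

orderIso-213⁺ : ∀ {a b c} → b < a → a < c → T (orderIso (a ∷ b ∷ c ∷ []) pat213)
orderIso-213⁺ {a} {b} {c} b<a a<c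
  with b<c ← <-trans b<a a<c
  rewrite <ᵇ-true b<a | <ᵇ-true a<c | <ᵇ-true b<c
        | <ᵇ-false (<⇒≯ b<a) | <ᵇ-false (<⇒≯ a<c) | <ᵇ-false (<⇒≯ b<c)
        | <ᵇ-false (n≮n a) | <ᵇ-false (n≮n b) | <ᵇ-false (n≮n c)
        | ≡ᵇ-true a | ≡ᵇ-true b | ≡ᵇ-true c
        | ≡ᵇ-false (>⇒≢ b<a) | ≡ᵇ-false (<⇒≢ b<a) | ≡ᵇ-false (<⇒≢ a<c)
        | ≡ᵇ-false (>⇒≢ a<c) | ≡ᵇ-false (<⇒≢ b<c) | ≡ᵇ-false (>⇒≢ b<c) = tt

T-contains213 : ∀ {x} → T (contains x pat213) ⇔ Contains213 x
T-contains213 {x} = mk⇔ out into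
  where
  isoᵇ : List ℕ → Bool
  isoᵇ y = orderIso y pat213
  out : T (contains x pat213) → Contains213 x
  out h with find (Anyₚ.any⁻ isoᵇ (subseqs x) h)
  ... | y , y∈ , iso with orderIso-213⁻ y iso
  ... | a , b , c , refl , lt = a , b , c , to ∈-subseqs y∈ , lt
  into : Contains213 x → T (contains x pat213)
  into (a , b , c , s , b<a , a<c) = Anyₚ.any⁺ isoᵇ (lose (from ∈-subseqs s) (orderIso-213⁺ b<a a<c))

T-avoids213 : ∀ {x} → T (avoids x pat213) ⇔ Avoids213 x
T-avoids213 {x} = mk⇔
  (λ h → from (Avoids213⇔¬Contains213 x) (to T-not h ∘ from T-contains213))
  (λ av → from T-not (to (Avoids213⇔¬Contains213 x) av ∘ to T-contains213))

Unique-concatMap : ∀ {A B : Set} (F : A → List B) {xs} → Unique xs → (∀ x → Unique (F x)) →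
  (∀ {x x′ z} → z ∈ F x → z ∈ F x′ → x ≡ x′) → Unique (concatMap F xs)
Unique-concatMap F uxs uF sep = Uniqueₚ.concat⁺ (Allₚ.map⁺ (All.universal uF _))
  (AllPairsₚ.map⁺ {f = F} (AllPairs.map (λ x≢x′ {_} (z∈ , z∈′) → x≢x′ (sep z∈ z∈′)) uxs))

InRange : ℕ → ℕ → Set
InRange m v = 1 ≤ v × v ≤ m

∈-wordsOver : ∀ l m {x} → x ∈ wordsOver l m ⇔ (length x ≡ l × All (InRange m) x)
∈-wordsOver l m = mk⇔ (out l) (into l)
  where
  extend : List ℕ → List (List ℕ)
  extend w = map (_∷ w) (range1 m)
  out : ∀ l {x} → x ∈ wordsOver l m → length x ≡ l × All (InRange m) x
  out zero (here refl) = refl , []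
  out (suc l) x∈ with find (∈-concatMap⁻ extend {xs = wordsOver l m} x∈)
  ... | w , w∈ , x∈′ with ∈-map⁻ (_∷ w) x∈′
  ... | v , v∈ , refl with out l w∈
  ... | len , inRange = cong suc len , to ∈-range1 v∈ ∷ inRange
  into : ∀ l {x} → length x ≡ l × All (InRange m) x → x ∈ wordsOver l m
  into zero    {[]}    (refl , []) = here refl
  into (suc l) {v ∷ w} (len , v∈ ∷ inRange) =
    ∈-concatMap⁺ extend (lose (into l (suc-injective len , inRange)) (∈-map⁺ (_∷ w) (from ∈-range1 v∈)))

wordsOver-unique : ∀ l m → Unique (wordsOver l m)
wordsOver-unique zero    m = [] AllPairs.∷ AllPairs.[]
wordsOver-unique (suc l) m =
  Unique-concatMap (λ w → map (_∷ w) (range1 m)) (wordsOver-unique l m)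
    (λ w → Uniqueₚ.map⁺ (proj₁ ∘ ∷-injective) range1-unique) sameTail
  where
  range1-unique : Unique (range1 m)
  range1-unique = Uniqueₚ.map⁺ suc-injective (Uniqueₚ.upTo⁺ m)
  sameTail : ∀ {w w′ z} → z ∈ map (_∷ w) (range1 m) → z ∈ map (_∷ w′) (range1 m) → w ≡ w′
  sameTail z∈ z∈′ with ∈-map⁻ (_∷ _) z∈ | ∈-map⁻ (_∷ _) z∈′
  ... | _ , _ , refl | _ , _ , eq = ∷-injectiveʳ eq

RAS213 : List ℕ → Set
RAS213 x = All (1 ≤_) x × Cayley x × RevisedAscent x × Avoids213 x

∈-Bhat : ∀ {n x} → x ∈ Bhat n pat213 ⇔ (RAS213 x × length x ≡ n)
∈-Bhat {n} {x} = mk⇔ out into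
  where
  good? = λ x → T? (isRevisedAscent x ∧ avoids x pat213)
  out : x ∈ Bhat n pat213 → RAS213 x × length x ≡ n
  out x∈ with ∈-filter⁻ good? x∈
  ... | x∈words , good with to (∈-wordsOver n n) x∈words | to T-∧ good
  ... | len , inRange | ras , av with to T-∧ ras
  ... | cay , asc =
    (All.map proj₁ inRange , to T-isCayley cay , to (T-sameAscbotNub x) asc , to T-avoids213 av) , len
  into : RAS213 x × length x ≡ n → x ∈ Bhat n pat213
  into ((pos , cay , asc , av) , len) = ∈-filter⁺ good? (from (∈-wordsOver n n) (len , inRange))
    (from T-∧ (from T-∧ (from T-isCayley cay , from (T-sameAscbotNub x) asc) , from T-avoids213 av))
    where
    inRange : All (InRange n) x
    inRange = All.zipWith (λ (1≤v , v≤max) → 1≤v , ≤-trans v≤max (subst (maxL x ≤_) len (Cayley⇒maxL≤length x cay)))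
                (pos , All.tabulate (≤-maxL x))

Bhat-unique : ∀ n → Unique (Bhat n pat213)
Bhat-unique n = Uniqueₚ.filter⁺ (λ x → T? (isRevisedAscent x ∧ avoids x pat213)) (wordsOver-unique n n)

∈-reverseAcc : ∀ {v : ℕ} S y → v ∈ reverseAcc S y ⇔ (v ∈ S ⊎ v ∈ y)
∈-reverseAcc S y = mk⇔ (Anyₚ.reverseAcc⁻ S y) (Anyₚ.reverseAcc⁺ S y)

NewIffAscent-++ : ∀ S y z next →
  NewIffAscent S (y ++ z) next ⇔ (NewIffAscent S y (z ++ next) × NewIffAscent (reverseAcc S y) z next)
NewIffAscent-++ S y z next = mk⇔ (split S y) (λ (hy , hz) → join S y hy hz)
  where
  split : ∀ S y → NewIffAscent S (y ++ z) next → NewIffAscent S y (z ++ next) × NewIffAscent (reverseAcc S y) z next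
  split S []      h = tt , h
  split S (a ∷ y) (c , h) rewrite ++-assoc y z next = let hy , hz = split (a ∷ S) y h in (c , hy) , hz
  join : ∀ S y → NewIffAscent S y (z ++ next) → NewIffAscent (reverseAcc S y) z next → NewIffAscent S (y ++ z) next
  join S []      _        hz = hz
  join S (a ∷ y) (c , hy) hz rewrite ++-assoc y z next = c , join (a ∷ S) y hy hz

NewIffAscent-cong : ∀ {S S′} y next → (∀ {v} → v ∈ y → v ∈ S ⇔ v ∈ S′) →
  NewIffAscent S y next → NewIffAscent S′ y next
NewIffAscent-cong []      next same _       = tt
NewIffAscent-cong (a ∷ y) next same (c , h) =
  atCong (y ++ next) (same (here refl)) c , NewIffAscent-cong y next same′ h
  where
  atCong : ∀ {S S′} t → a ∈ S ⇔ a ∈ S′ → NewIffAscentAt S a t → NewIffAscentAt S′ a t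
  atCong []      e a∈ = to e a∈
  atCong (b ∷ t) e (new⇒asc , asc⇒new) = (λ ∉S′ → new⇒asc (∉S′ ∘ to e)) , (λ a<b → asc⇒new a<b ∘ from e)
  same′ : ∀ {v} → v ∈ y → v ∈ a ∷ _ ⇔ v ∈ a ∷ _
  same′ v∈ = mk⇔ (λ { (here eq) → here eq ; (there w) → there (to (same (there v∈)) w) })
                 (λ { (here eq) → here eq ; (there w) → there (from (same (there v∈)) w) })

∈-map-+ : ∀ q {v} S → v ∈ S ⇔ q + v ∈ map (q +_) S
∈-map-+ q {v} S = mk⇔ (∈-map⁺ (q +_)) λ qv∈ → let w , w∈ , eq = ∈-map⁻ (q +_) qv∈ in
                                               subst (_∈ S) (sym (+-cancelˡ-≡ q v w eq)) w∈

NewIffAscent-shift : ∀ q S y next → NewIffAscent S y next ⇔ NewIffAscent (map (q +_) S) (map (q +_) y) (map (q +_) next)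
NewIffAscent-shift q S []      next = mk⇔ _ _
NewIffAscent-shift q S (a ∷ y) next =
  subst (λ t → _ ⇔ NewIffAscentAt (map (q +_) S) (q + a) t) (map-++ (q +_) y next) (atShift (y ++ next))
  ×-⇔ NewIffAscent-shift q (a ∷ S) y next
  where
  atShift : ∀ t → NewIffAscentAt S a t ⇔ NewIffAscentAt (map (q +_) S) (q + a) (map (q +_) t)
  atShift []      = ∈-map-+ q S
  atShift (b ∷ t) = mk⇔
    (λ (new⇒asc , asc⇒new) → (λ ∉S → +-monoʳ-< q (new⇒asc (∉S ∘ to (∈-map-+ q S)))) ,
                              (λ lt → asc⇒new (+-cancelˡ-< q a b lt) ∘ from (∈-map-+ q S)))
    (λ (new⇒asc , asc⇒new) → (λ ∉S → +-cancelˡ-< q a b (new⇒asc (∉S ∘ from (∈-map-+ q S)))) ,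
                              (λ lt → asc⇒new (+-monoʳ-< q lt) ∘ to (∈-map-+ q S)))

-- Given b ≤ y, the last entry of y must be old whether it ends the word or precedes b.
NewIffAscent-[]⇔∷ : ∀ S y b next → All (b ≤_) y → NewIffAscent S y [] ⇔ NewIffAscent S y (b ∷ next)
NewIffAscent-[]⇔∷ S []          b next _           = mk⇔ _ _
NewIffAscent-[]⇔∷ S (a ∷ [])    b next (b≤a ∷ [])  = mk⇔
  (λ (a∈ , _) → ((λ ∉S → contradiction a∈ ∉S) , (λ a<b → contradiction b≤a (<⇒≱ a<b))) , tt)
  (λ ((new⇒asc , _) , _) → decidable-stable (a ∈? S) (λ ∉S → <⇒≱ (new⇒asc ∉S) b≤a) , tt)
NewIffAscent-[]⇔∷ S (a ∷ y@(_ ∷ _)) b next (_ ∷ b≤y) =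
  mk⇔ id id ×-⇔ NewIffAscent-[]⇔∷ (a ∷ S) y b next b≤y

-- A value above everything seen is new, hence followed by a still larger value, and so on forever.
above-seen-never-ends : ∀ S v y → All (_< v) S → ¬ NewIffAscent S (v ∷ y) []
above-seen-never-ends S v []      v>S (v∈ , _) = n≮n v (All.lookup v>S v∈)
above-seen-never-ends S v (w ∷ y) v>S ((new⇒asc , _) , h) =
  above-seen-never-ends (v ∷ S) w y (v<w ∷ All.map (λ s<v → <-trans s<v v<w) v>S) h
  where
  v<w = new⇒asc (λ v∈ → n≮n v (All.lookup v>S v∈))

NewIffAscent⇒bounded : ∀ a S y → All (_≤ a) S → NewIffAscent S y [] → All (_≤ a) y
NewIffAscent⇒bounded a S []      _   _       = []
NewIffAscent⇒bounded a S (b ∷ y) S≤a h with b ≤? a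
... | yes b≤a = b≤a ∷ NewIffAscent⇒bounded a (b ∷ S) y (b≤a ∷ S≤a) (proj₂ h)
... | no  b≰a = contradiction h (above-seen-never-ends S b y (All.map (λ s≤a → ≤-<-trans s≤a (≰⇒> b≰a)) S≤a))

RevisedAscent⇒head-max : ∀ a y → RevisedAscent (a ∷ y) → All (_≤ a) y
RevisedAscent⇒head-max a y = NewIffAscent⇒bounded a [ a ] y (≤-refl ∷ [])

-- An old 1 cannot ascend, so it is followed by another (old) 1.
NewIffAscent-after-old-1 : ∀ S z → 1 ∈ S → All (1 ≤_) z → NewIffAscent S (1 ∷ z) [] → z ≡ replicate (length z) 1
NewIffAscent-after-old-1 S []      _  _          _                   = refl
NewIffAscent-after-old-1 S (c ∷ z) 1∈ (1≤c ∷ 1≤z) ((_ , asc⇒new) , h) with c ≤? 1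
... | no  c≰1 = contradiction 1∈ (asc⇒new (≰⇒> c≰1))
... | yes c≤1 with ≤-antisym c≤1 1≤c
... | refl = cong (1 ∷_) (NewIffAscent-after-old-1 (1 ∷ S) z (here refl) 1≤z h)

NewIffAscent-ones : ∀ S r → 1 ∈ S → NewIffAscent S (replicate r 1) []
NewIffAscent-ones S zero          1∈ = tt
NewIffAscent-ones S (suc zero)    1∈ = 1∈ , tt
NewIffAscent-ones S (suc (suc r)) 1∈ =
  ((λ 1∉ → contradiction 1∈ 1∉) , (λ 1<1 → contradiction 1<1 (n≮n 1))) , NewIffAscent-ones (1 ∷ S) (suc r) (here refl)

No213From-bounded : ∀ a z → All (_≤ a) z → No213From a z
No213From-bounded a []      _          = tt
No213From-bounded a (b ∷ z) (_ ∷ z≤a) = (λ _ → z≤a) , No213From-bounded a z z≤a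

No213From-1 : ∀ z → All (1 ≤_) z → No213From 1 z
No213From-1 []      _           = tt
No213From-1 (b ∷ z) (1≤b ∷ 1≤z) = (λ b<1 → contradiction 1≤b (<⇒≱ b<1)) , No213From-1 z 1≤z

No213From-++ : ∀ a y z → No213From a y → All (_≤ a) z → No213From a (y ++ z)
No213From-++ a []      z _          z≤a = No213From-bounded a z z≤a
No213From-++ a (b ∷ y) z (≤a , free) z≤a = (λ b<a → Allₚ.++⁺ (≤a b<a) z≤a) , No213From-++ a y z free z≤a

No213From-++⁻ : ∀ a y z → No213From a (y ++ z) → No213From a y × No213From a z
No213From-++⁻ a []      z free         = tt , free
No213From-++⁻ a (b ∷ y) z (≤a , free) =
  let fy , fz = No213From-++⁻ a y z free in ((λ b<a → Allₚ.++⁻ˡ y (≤a b<a)) , fy) , fz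

Avoids213-++ : ∀ y z → Avoids213 y → Avoids213 z → All (λ a → All (_≤ a) z) y → Avoids213 (y ++ z)
Avoids213-++ []      z _           avz _           = avz
Avoids213-++ (a ∷ y) z (free , avy) avz (z≤a ∷ z≤y) = No213From-++ a y z free z≤a , Avoids213-++ y z avy avz z≤y

Avoids213-++⁻ : ∀ y z → Avoids213 (y ++ z) → Avoids213 y × Avoids213 z
Avoids213-++⁻ []      z av          = tt , av
Avoids213-++⁻ (a ∷ y) z (free , av) =
  let avy , avz = Avoids213-++⁻ y z av in (proj₁ (No213From-++⁻ a y z free) , avy) , avz

Avoids213-++⇒No213From : ∀ y z {a} → Avoids213 (y ++ z) → a ∈ y → No213From a z
Avoids213-++⇒No213From (b ∷ y) z (free , _) (here refl) = proj₂ (No213From-++⁻ b y z free)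
Avoids213-++⇒No213From (b ∷ y) z (_ , av)   (there a∈)  = Avoids213-++⇒No213From y z av a∈

All≤-shift : ∀ q a y → All (_≤ a) y ⇔ All (_≤ q + a) (map (q +_) y)
All≤-shift q a y = mk⇔ (Allₚ.map⁺ ∘ All.map (+-monoʳ-≤ q)) (All.map (+-cancelˡ-≤ q _ a) ∘ Allₚ.map⁻)

No213From-shift : ∀ q a y → No213From a y ⇔ No213From (q + a) (map (q +_) y)
No213From-shift q a []      = mk⇔ _ _
No213From-shift q a (b ∷ y) =
  mk⇔ (λ ≤a → to (All≤-shift q a y) ∘ ≤a ∘ +-cancelˡ-< q b a) (λ ≤a → from (All≤-shift q a y) ∘ ≤a ∘ +-monoʳ-< q)
  ×-⇔ No213From-shift q a y

Avoids213-shift : ∀ q y → Avoids213 y ⇔ Avoids213 (map (q +_) y)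
Avoids213-shift q []      = mk⇔ _ _
Avoids213-shift q (a ∷ y) = No213From-shift q a y ×-⇔ Avoids213-shift q y

Avoids213-ones : ∀ r → Avoids213 (replicate r 1)
Avoids213-ones zero    = tt
Avoids213-ones (suc r) = No213From-bounded 1 (replicate r 1) (Allₚ.replicate⁺ r ≤-refl) , Avoids213-ones r

∈-map-+-lower : ∀ {q v P} → All (1 ≤_) P → v ∈ map (q +_) P → suc q ≤ v
∈-map-+-lower {q} P-pos v∈ with ∈-map⁻ (q +_) v∈
... | w , w∈ , refl = subst (_≤ q + w) (+-comm q 1) (+-monoʳ-≤ q (All.lookup P-pos w∈))

suc∈map-+ : ∀ {q P} → 1 ∈ P → suc q ∈ map (q +_) P
suc∈map-+ {q} {P} 1∈P = subst (_∈ map (q +_) P) (+-comm q 1) (∈-map⁺ (q +_) 1∈P)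

1∉map-+ : ∀ {q P} → 1 ≤ q → All (1 ≤_) P → 1 ∉ map (q +_) P
1∉map-+ q-pos P-pos 1∈ = contradiction (≤-trans (s≤s q-pos) (∈-map-+-lower P-pos 1∈)) (n≮n 1)

-- Gluing two shorter sequences

-- The junk clause for Q = [] is never used.
glue : List ℕ → List ℕ → ℕ → List ℕ
glue P []       r = []
glue P (q ∷ Q′) r = map (q +_) P ++ 1 ∷ map suc Q′ ++ replicate r 1

length-glue : ∀ P q Q′ r → length (glue P (q ∷ Q′) r) ≡ length P + (length (q ∷ Q′) + r)
length-glue P q Q′ r = begin
  length (map (q +_) P ++ 1 ∷ map suc Q′ ++ replicate r 1)  ≡⟨ length-++ (map (q +_) P) ⟩
  length (map (q +_) P) + suc (length (map suc Q′ ++ replicate r 1))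
    ≡⟨ cong₂ (λ m n → m + suc n) (length-map (q +_) P) (length-++ (map suc Q′)) ⟩
  length P + suc (length (map suc Q′) + length (replicate r 1))
    ≡⟨ cong₂ (λ m n → length P + suc (m + n)) (length-map suc Q′) (length-replicate r) ⟩
  length P + (length (q ∷ Q′) + r)                          ∎
  where open ≡-Reasoning

module Glue (p : ℕ) (P′ : List ℕ) (q c : ℕ) (Q″ : List ℕ) (r : ℕ)
            (P-pos : All (1 ≤_) (p ∷ P′)) (1∈P : 1 ∈ p ∷ P′)
            (Q′-pos : All (1 ≤_) (c ∷ Q″)) (Q′≤q : All (_≤ q) (c ∷ Q″)) where

  P Q′ rest x : List ℕ
  P    = p ∷ P′
  Q′   = c ∷ Q″
  rest = map suc Q′ ++ replicate r 1
  x    = glue P (q ∷ Q′) r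

  q+P-lower : ∀ {v} → v ∈ map (q +_) P → suc q ≤ v
  q+P-lower = ∈-map-+-lower P-pos

  suc-q∈q+P : suc q ∈ map (q +_) P
  suc-q∈q+P = suc∈map-+ 1∈P

  sucQ′-lower : All (2 ≤_) (map suc Q′)
  sucQ′-lower = Allₚ.map⁺ (All.map s≤s Q′-pos)

  sucQ′-upper : All (_≤ suc q) (map suc Q′)
  sucQ′-upper = Allₚ.map⁺ (All.map s≤s Q′≤q)

  q-pos : 1 ≤ q
  q-pos = ≤-trans (All.head Q′-pos) (All.head Q′≤q)

  maxQ≡q : maxL (q ∷ Q′) ≡ q
  maxQ≡q = m≥n⇒m⊔n≡m (maxL-≤ Q′ Q′≤q)

  ∈-glue⁻ : ∀ {v} → v ∈ x → v ∈ map (q +_) P ⊎ v ≡ 1 ⊎ v ∈ map suc Q′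
  ∈-glue⁻ v∈ with ∈-++⁻ (map (q +_) P) v∈
  ... | inj₁ v∈P           = inj₁ v∈P
  ... | inj₂ (here refl)   = inj₂ (inj₁ refl)
  ... | inj₂ (there v∈rest) with ∈-++⁻ (map suc Q′) v∈rest
  ...   | inj₁ v∈Q′  = inj₂ (inj₂ v∈Q′)
  ...   | inj₂ v∈1s  = inj₂ (inj₁ (All.lookup (Allₚ.replicate⁺ {P = _≡ 1} r refl) v∈1s))

  positive : All (1 ≤_) x
  positive = Allₚ.++⁺ (Allₚ.map⁺ (All.map (λ 1≤w → ≤-trans 1≤w (m≤n+m _ q)) P-pos))
               (≤-refl ∷ Allₚ.++⁺ (All.map (≤-trans (s≤s z≤n)) sucQ′-lower) (Allₚ.replicate⁺ r ≤-refl))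

  maxL-glue : maxL x ≡ q + maxL P
  maxL-glue = ≤-antisym (maxL-≤ x upper) (≤-maxL x (∈-++⁺ˡ (∈-map⁺ (q +_) (maxL-∈ p P′))))
    where
    suc-q≤ : suc q ≤ q + maxL P
    suc-q≤ = subst (_≤ q + maxL P) (+-comm q 1) (+-monoʳ-≤ q (≤-trans (All.head P-pos) (≤-maxL P (here refl))))
    upper : All (_≤ q + maxL P) x
    upper = Allₚ.++⁺ (Allₚ.map⁺ (All.map (+-monoʳ-≤ q) (All.tabulate (≤-maxL P))))
              (≤-trans (s≤s z≤n) suc-q≤ ∷
               Allₚ.++⁺ (All.map (λ v≤ → ≤-trans v≤ suc-q≤) sucQ′-upper)
                        (Allₚ.replicate⁺ r (≤-trans (s≤s z≤n) suc-q≤)))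

  Cayley⇔ : Cayley x ⇔ (Cayley P × Cayley (q ∷ Q′))
  Cayley⇔ = mk⇔ (λ cay → cayleyP cay , cayleyQ cay) (λ (cayP , cayQ) → cayleyX cayP cayQ)
    where
    cayleyP : Cayley x → Cayley P
    cayleyP cay v 1≤v v≤max with ∈-glue⁻ (cay (q + v) (≤-trans 1≤v (m≤n+m v q))
                                         (subst (q + v ≤_) (sym maxL-glue) (+-monoʳ-≤ q v≤max)))
    ... | inj₁ qv∈       = from (∈-map-+ q P) qv∈
    ... | inj₂ (inj₁ eq) = contradiction eq (>⇒≢ (+-mono-≤ q-pos 1≤v))
    ... | inj₂ (inj₂ qv∈) with ≤-antisym (+-cancelˡ-≤ q v 1 (subst (q + v ≤_) (+-comm 1 q) (All.lookup sucQ′-upper qv∈))) 1≤v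
    ...   | refl = 1∈P
    cayleyQ : Cayley x → Cayley (q ∷ Q′)
    cayleyQ cay v 1≤v v≤max with v ≟ q
    ... | yes refl = here refl
    ... | no  v≢q  = fromSuc (∈-glue⁻ (cay (suc v) (s≤s z≤n) (≤-trans (s≤s (<⇒≤ v<q)) (≤-maxL x (∈-++⁺ˡ suc-q∈q+P)))))
      where
      v<q : v < q
      v<q = ≤∧≢⇒< (subst (v ≤_) maxQ≡q v≤max) v≢q
      fromSuc : suc v ∈ map (q +_) P ⊎ suc v ≡ 1 ⊎ suc v ∈ map suc Q′ → v ∈ q ∷ Q′
      fromSuc (inj₁ sv∈)        = contradiction (≤-pred (q+P-lower sv∈)) (<⇒≱ v<q)
      fromSuc (inj₂ (inj₁ eq))  = contradiction (suc-injective eq) (>⇒≢ 1≤v)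
      fromSuc (inj₂ (inj₂ sv∈)) = there (from (∈-map-+ 1 Q′) sv∈)
    cayleyX : Cayley P → Cayley (q ∷ Q′) → Cayley x
    cayleyX cayP cayQ (suc zero) _ _ = ∈-++⁺ʳ (map (q +_) P) (here refl)
    cayleyX cayP cayQ v@(suc w@(suc _)) _ v≤max with w <? q
    ... | yes w<q with cayQ w (s≤s z≤n) (subst (w ≤_) (sym maxQ≡q) (<⇒≤ w<q))
    ...   | here refl = contradiction w<q (n≮n w)
    ...   | there w∈  = ∈-++⁺ʳ (map (q +_) P) (there (∈-++⁺ˡ (∈-map⁺ suc w∈)))
    cayleyX cayP cayQ v _ v≤max | no w≮q =
      subst (_∈ x) (m+[n∸m]≡n (<⇒≤ q<v))
        (∈-++⁺ˡ (∈-map⁺ (q +_) (cayP (v ∸ q) (m<n⇒0<n∸m q<v) (m≤n+o⇒m∸n≤o v q (subst (v ≤_) maxL-glue v≤max)))))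
      where
      q<v = s≤s (≮⇒≥ w≮q)

  seen : List ℕ
  seen = reverseAcc [ q + p ] (map (q +_) P′)

  ∈-seen : ∀ {v} → v ∈ seen ⇔ v ∈ map (q +_) P
  ∈-seen = mk⇔
    (λ v∈ → case-seen (to (∈-reverseAcc [ q + p ] (map (q +_) P′)) v∈))
    (λ { (here eq) → from (∈-reverseAcc [ q + p ] (map (q +_) P′)) (inj₁ (here eq))
       ; (there v∈) → from (∈-reverseAcc [ q + p ] (map (q +_) P′)) (inj₂ v∈) })
    where
    case-seen : ∀ {v} → v ∈ [ q + p ] ⊎ v ∈ map (q +_) P′ → v ∈ map (q +_) P
    case-seen (inj₁ (here eq)) = here eq
    case-seen (inj₂ v∈)        = there v∈

  -- Only suc q, which lies in q + P, can be both seen and a value of Q′ + 1.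
  seen-agrees : ∀ {v} → v ∈ map suc Q′ → v ∈ [ suc q ] ⇔ v ∈ 1 ∷ seen
  seen-agrees v∈ = mk⇔
    (λ { (here refl) → there (from ∈-seen suc-q∈q+P) })
    (λ { (here refl) → contradiction (All.lookup sucQ′-lower v∈) (n≮n 1)
       ; (there w∈)  → here (≤-antisym (All.lookup sucQ′-upper v∈) (q+P-lower (to ∈-seen w∈))) })

  tail⇔ : NewIffAscent seen (1 ∷ rest) [] ⇔ RevisedAscent (q ∷ Q′)
  tail⇔ = begin
    NewIffAscent seen (1 ∷ rest) []
      ≈⟨ holds⇒×⇔ 1-ascends ⟩
    NewIffAscent (1 ∷ seen) (map suc Q′ ++ replicate r 1) []
      ≈⟨ NewIffAscent-++ (1 ∷ seen) (map suc Q′) (replicate r 1) [] ⟩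
    (NewIffAscent (1 ∷ seen) (map suc Q′) (replicate r 1 ++ []) × NewIffAscent _ (replicate r 1) [])
      ≈⟨ ×-holds⇔ (NewIffAscent-ones _ r (from (∈-reverseAcc _ (map suc Q′)) (inj₁ (here refl)))) ⟩
    NewIffAscent (1 ∷ seen) (map suc Q′) (replicate r 1 ++ [])
      ≈⟨ dropOnes r ⟨
    NewIffAscent (1 ∷ seen) (map suc Q′) []
      ≈⟨ mk⇔ (NewIffAscent-cong (map suc Q′) [] (⇔-sym ∘ seen-agrees))
             (NewIffAscent-cong (map suc Q′) [] seen-agrees) ⟩
    NewIffAscent [ suc q ] (map suc Q′) []
      ≈⟨ NewIffAscent-shift 1 [ q ] Q′ [] ⟨
    RevisedAscent (q ∷ Q′) ∎
    where
    open SetoidReasoning (⇔-setoid 0ℓ)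
    holds⇒×⇔ : ∀ {A B : Set} → A → (A × B) ⇔ B
    holds⇒×⇔ a = mk⇔ proj₂ (a ,_)
    ×-holds⇔ : ∀ {A B : Set} → B → (A × B) ⇔ A
    ×-holds⇔ b = mk⇔ proj₁ (_, b)
    1-ascends : NewIffAscentAt seen 1 (rest ++ [])
    1-ascends = (λ _ → s≤s (All.head Q′-pos)) ,
              (λ _ 1∈ → contradiction (q+P-lower (to ∈-seen 1∈)) (<⇒≱ (s≤s q-pos)))
    dropOnes : ∀ r → NewIffAscent (1 ∷ seen) (map suc Q′) [] ⇔ NewIffAscent (1 ∷ seen) (map suc Q′) (replicate r 1 ++ [])
    dropOnes zero    = mk⇔ id id
    dropOnes (suc r) = NewIffAscent-[]⇔∷ (1 ∷ seen) (map suc Q′) 1 (replicate r 1 ++ [])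
                         (All.map (≤-trans (s≤s z≤n)) sucQ′-lower)

  RevisedAscent⇔ : RevisedAscent x ⇔ (RevisedAscent P × RevisedAscent (q ∷ Q′))
  RevisedAscent⇔ = begin
    RevisedAscent x
      ≈⟨ NewIffAscent-++ [ q + p ] (map (q +_) P′) (1 ∷ rest) [] ⟩
    (NewIffAscent [ q + p ] (map (q +_) P′) ((1 ∷ rest) ++ []) × NewIffAscent seen (1 ∷ rest) [])
      ≈⟨ ⇔-sym (NewIffAscent-[]⇔∷ _ (map (q +_) P′) 1 (rest ++ []) q+P′-pos) ×-⇔ tail⇔ ⟩
    (NewIffAscent [ q + p ] (map (q +_) P′) [] × RevisedAscent (q ∷ Q′))
      ≈⟨ ⇔-sym (NewIffAscent-shift q [ p ] P′ []) ×-⇔ mk⇔ id id ⟩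
    (RevisedAscent P × RevisedAscent (q ∷ Q′)) ∎
    where
    open SetoidReasoning (⇔-setoid 0ℓ)
    q+P′-pos : All (1 ≤_) (map (q +_) P′)
    q+P′-pos = Allₚ.map⁺ (All.map (λ 1≤w → ≤-trans 1≤w (m≤n+m _ q)) (All.tail P-pos))

  Avoids213⇔ : Avoids213 x ⇔ (Avoids213 P × Avoids213 (q ∷ Q′))
  Avoids213⇔ = mk⇔ split join
    where
    rest-pos : All (1 ≤_) rest
    rest-pos = All.tail (Allₚ.++⁻ʳ (map (q +_) P) positive)
    tail-upper : All (_≤ suc q) (1 ∷ rest)
    tail-upper = s≤s z≤n ∷ Allₚ.++⁺ sucQ′-upper (Allₚ.replicate⁺ r (s≤s z≤n))
    split : Avoids213 x → Avoids213 P × Avoids213 (q ∷ Q′)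
    split av =
      let avP , av1rest = Avoids213-++⁻ (map (q +_) P) (1 ∷ rest) av in
      from (Avoids213-shift q P) avP ,
      No213From-bounded q Q′ Q′≤q ,
      from (Avoids213-shift 1 Q′) (proj₁ (Avoids213-++⁻ (map suc Q′) (replicate r 1) (proj₂ av1rest)))
    join : Avoids213 P × Avoids213 (q ∷ Q′) → Avoids213 x
    join (avP , _ , avQ′) =
      Avoids213-++ (map (q +_) P) (1 ∷ rest) (to (Avoids213-shift q P) avP)
        (No213From-1 rest rest-pos ,
         Avoids213-++ (map suc Q′) (replicate r 1) (to (Avoids213-shift 1 Q′) avQ′) (Avoids213-ones r)
           (All.map (λ 2≤v → Allₚ.replicate⁺ r (≤-trans (s≤s z≤n) 2≤v)) sucQ′-lower))
        (All.tabulate λ a∈ → All.map (λ v≤ → ≤-trans v≤ (q+P-lower a∈)) tail-upper)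

  RAS213⇔ : RAS213 x ⇔ (RAS213 P × RAS213 (q ∷ Q′))
  RAS213⇔ = mk⇔
    (λ (_ , cay , asc , av) →
      let cayP , cayQ = to Cayley⇔ cay ; ascP , ascQ = to RevisedAscent⇔ asc ; avP , avQ = to Avoids213⇔ av in
      (P-pos , cayP , ascP , avP) , (q-pos ∷ Q′-pos , cayQ , ascQ , avQ))
    (λ ((_ , cayP , ascP , avP) , (_ , cayQ , ascQ , avQ)) →
      positive , from Cayley⇔ (cayP , cayQ) , from RevisedAscent⇔ (ascP , ascQ) , from Avoids213⇔ (avP , avQ))

++-∷-cancel : ∀ {v : ℕ} A B A₂ B₂ → v ∉ A → v ∉ A₂ → A ++ v ∷ B ≡ A₂ ++ v ∷ B₂ → A ≡ A₂ × B ≡ B₂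
++-∷-cancel []      B []        B₂ _  _  refl = refl , refl
++-∷-cancel []      B (a ∷ A₂)  B₂ _  v∉ eq   = contradiction (here (proj₁ (∷-injective eq))) v∉
++-∷-cancel (a ∷ A) B []        B₂ v∉ _  eq   = contradiction (here (sym (proj₁ (∷-injective eq)))) v∉
++-∷-cancel (a ∷ A) B (a₂ ∷ A₂) B₂ v∉ v∉₂ eq with ∷-injective eq
... | refl , eq′ = let eqA , eqB = ++-∷-cancel A B A₂ B₂ (v∉ ∘ there) (v∉₂ ∘ there) eq′ in cong (a ∷_) eqA , eqB

++-replicate-cancel : ∀ {v : ℕ} Y r Y₂ r₂ → v ∉ Y → v ∉ Y₂ → Y ++ replicate r v ≡ Y₂ ++ replicate r₂ v → Y ≡ Y₂
++-replicate-cancel []      r       []        r₂       _  _  _  = refl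
++-replicate-cancel []      (suc r) (b ∷ Y₂)  r₂       _  v∉ eq = contradiction (here (proj₁ (∷-injective eq))) v∉
++-replicate-cancel (a ∷ Y) r       []        (suc r₂) v∉ _  eq = contradiction (here (sym (proj₁ (∷-injective eq)))) v∉
++-replicate-cancel (a ∷ Y) r       (a₂ ∷ Y₂) r₂       v∉ v∉₂ eq with ∷-injective eq
... | refl , eq′ = cong (a ∷_) (++-replicate-cancel Y r Y₂ r₂ (v∉ ∘ there) (v∉₂ ∘ there) eq′)

-- The first 1 ends the block q + P, whose least value suc q determines q.
glue-injective : ∀ {P q Q′ r P₂ q₂ Q₂′ r₂} →
  All (1 ≤_) P → 1 ∈ P → 1 ≤ q → All (1 ≤_) Q′ →
  All (1 ≤_) P₂ → 1 ∈ P₂ → 1 ≤ q₂ → All (1 ≤_) Q₂′ →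
  glue P (q ∷ Q′) r ≡ glue P₂ (q₂ ∷ Q₂′) r₂ → P ≡ P₂ × q ∷ Q′ ≡ q₂ ∷ Q₂′
glue-injective {P} {q} {Q′} {r} {P₂} {q₂} {Q₂′} {r₂} P-pos 1∈P q-pos Q′-pos P₂-pos 1∈P₂ q₂-pos Q₂′-pos eq
  with ++-∷-cancel (map (q +_) P) _ (map (q₂ +_) P₂) _ (1∉map-+ q-pos P-pos) (1∉map-+ q₂-pos P₂-pos) eq
... | eqP , eqRest = eqP′ , cong₂ _∷_ q≡q₂ eqQ′
  where
  q≡q₂ : q ≡ q₂
  q≡q₂ = suc-injective (≤-antisym (∈-map-+-lower P-pos (subst (suc q₂ ∈_) (sym eqP) (suc∈map-+ 1∈P₂)))
                                  (∈-map-+-lower P₂-pos (subst (suc q ∈_) eqP (suc∈map-+ 1∈P))))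
  eqP′ : P ≡ P₂
  eqP′ = map-injective (+-cancelˡ-≡ q _ _) (subst (λ z → map (q +_) P ≡ map (z +_) P₂) (sym q≡q₂) eqP)
  eqQ′ : Q′ ≡ Q₂′
  eqQ′ = map-injective suc-injective
    (++-replicate-cancel (map suc Q′) r (map suc Q₂′) r₂ (1∉map-+ ≤-refl Q′-pos) (1∉map-+ ≤-refl Q₂′-pos) eqRest)

-- Decomposing a sequence that does not start with 1

1∈-RAS213 : ∀ {p P′} → RAS213 (p ∷ P′) → 1 ∈ p ∷ P′
1∈-RAS213 {p} {P′} (pos , cay , _) = cay 1 ≤-refl (≤-trans (All.head pos) (≤-maxL (p ∷ P′) (here refl)))

RAS213-head-1 : ∀ y → RAS213 (1 ∷ y) → y ≡ replicate (length y) 1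
RAS213-head-1 y (pos , _ , asc , _) = all-1 y (All.tail pos) (RevisedAscent⇒head-max 1 y asc)
  where
  all-1 : ∀ y → All (1 ≤_) y → All (_≤ 1) y → y ≡ replicate (length y) 1
  all-1 []      _           _           = refl
  all-1 (b ∷ y) (1≤b ∷ 1≤y) (b≤1 ∷ y≤1) = cong₂ _∷_ (≤-antisym b≤1 1≤b) (all-1 y 1≤y y≤1)

first-1 : ∀ x → 1 ∉ x ⊎ ∃₂ λ A R → x ≡ A ++ 1 ∷ R × 1 ∉ A
first-1 x with First.first (λ v → Sum.swap (Dec.toSum (1 ≟ v))) x
... | inj₂ ≢1 = inj₁ (Allₚ.All¬⇒¬Any ≢1)
... | inj₁ fst with toView fst
... | ≢1 First.++ refl ∷ R = inj₂ (_ , R , refl , Allₚ.All¬⇒¬Any ≢1)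

1-free-then-ones : ∀ S R → 1 ∈ S → All (1 ≤_) R → NewIffAscent S R [] →
  ∃₂ λ R′ r → R ≡ R′ ++ replicate r 1 × 1 ∉ R′
1-free-then-ones S R 1∈S R-pos asc with first-1 R
... | inj₁ 1∉R = R , 0 , sym (++-identityʳ R) , 1∉R
... | inj₂ (R′ , R₂ , refl , 1∉R′) = R′ , suc (length R₂) , cong (λ z → R′ ++ 1 ∷ z) only-1s , 1∉R′
  where
  only-1s : R₂ ≡ replicate (length R₂) 1
  only-1s = NewIffAscent-after-old-1 (reverseAcc S R′) R₂ (from (∈-reverseAcc S R′) (inj₁ 1∈S))
              (All.tail (Allₚ.++⁻ʳ R′ R-pos)) (proj₂ (to (NewIffAscent-++ S R′ (1 ∷ R₂) []) asc))

unshift : ∀ q A → All (suc q ≤_) A → ∃ λ P → A ≡ map (q +_) P × All (1 ≤_) P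
unshift q []      []         = [] , refl , []
unshift q (a ∷ A) (q<a ∷ q<A) with unshift q A q<A
... | P , refl , P-pos = a ∸ q ∷ P , cong (_∷ map (q +_) P) (sym (m+[n∸m]≡n (<⇒≤ q<a))) , m<n⇒0<n∸m q<a ∷ P-pos

record Glued (x : List ℕ) : Set where
  constructor glued
  field
    p      : ℕ
    P′     : List ℕ
    q c    : ℕ
    Q″     : List ℕ
    r      : ℕ
    P-pos  : All (1 ≤_) (p ∷ P′)
    1∈P    : 1 ∈ p ∷ P′
    Q′-pos : All (1 ≤_) (c ∷ Q″)
    Q′≤q   : All (_≤ q) (c ∷ Q″)
    x≡glue : x ≡ glue (p ∷ P′) (q ∷ c ∷ Q″) r

first-1-ascends : ∀ {S} R r → 1 ∉ S → NewIffAscentAt S 1 ((R ++ replicate r 1) ++ []) → R ≢ []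
first-1-ascends [] zero    1∉S 1∈S            refl = 1∉S 1∈S
first-1-ascends [] (suc r) 1∉S (new⇒asc , _) refl = n≮n 1 (new⇒asc 1∉S)

glued-from-split : ∀ a A′ R′ r → 1 ∉ a ∷ A′ → 1 ∉ R′ →
  RAS213 (a ∷ A′ ++ 1 ∷ R′ ++ replicate r 1) → Glued (a ∷ A′ ++ 1 ∷ R′ ++ replicate r 1)
glued-from-split a A′ R′ r 1∉A 1∉R′ (pos , _ , asc , av) =
  build (min a A′) min∈ (min≤⊤ a A′ ∷ min≤xs a A′)
  where
  A rest : List ℕ
  A    = a ∷ A′
  rest = R′ ++ replicate r 1
  no-1⇒≥2 : ∀ {B} → All (1 ≤_) B → 1 ∉ B → All (2 ≤_) B
  no-1⇒≥2 B-pos 1∉B = All.tabulate λ v∈ → ≤∧≢⇒< (All.lookup B-pos v∈) λ eq → 1∉B (subst (_∈ _) (sym eq) v∈)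
  A≥2 : All (2 ≤_) A
  A≥2 = no-1⇒≥2 (Allₚ.++⁻ˡ A pos) 1∉A
  R′≥2 : All (2 ≤_) R′
  R′≥2 = no-1⇒≥2 (Allₚ.++⁻ˡ R′ (All.tail (Allₚ.++⁻ʳ A pos))) 1∉R′
  min∈ : min a A′ ∈ A
  min∈ with argmin-sel id a A′
  ... | inj₁ min≡a = here min≡a
  ... | inj₂ min∈A′ = there min∈A′
  R′≢[] : R′ ≢ []
  R′≢[] = first-1-ascends R′ r
    (λ 1∈ → Sum.[ (λ { (here eq) → 1∉A (here eq) }) , 1∉A ∘ there ] (to (∈-reverseAcc [ a ] A′) 1∈))
    (proj₁ (proj₂ (to (NewIffAscent-++ [ a ] A′ (1 ∷ rest) []) asc)))
  build : ∀ μ → μ ∈ A → All (μ ≤_) A → Glued (A ++ 1 ∷ rest)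
  build zero             μ∈ _   = contradiction (All.lookup A≥2 μ∈) λ ()
  build (suc zero)       μ∈ _   = contradiction (All.lookup A≥2 μ∈) (n≮n 1)
  build (suc q@(suc _)) μ∈ μ≤A with unshift q A μ≤A | unshift 1 R′ R′≥2
  ... | [] , () , _         | _
  ... | _                   | [] , eqR , _ = contradiction eqR R′≢[]
  ... | p ∷ P′ , eqA , P-pos | c ∷ Q″ , eqR , Q′-pos =
    glued p P′ q c Q″ r P-pos 1∈P Q′-pos Q′≤q (cong₂ (λ X Y → X ++ 1 ∷ Y ++ replicate r 1) eqA eqR)
    where
    1∈P : 1 ∈ p ∷ P′
    1∈P = from (∈-map-+ q (p ∷ P′)) (subst (_∈ map (q +_) (p ∷ P′)) (sym (+-comm q 1)) (subst (suc q ∈_) eqA μ∈))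
    rest≤ : All (_≤ suc q) rest
    rest≤ = proj₁ (Avoids213-++⇒No213From A (1 ∷ rest) av μ∈) (s≤s (s≤s z≤n))
    Q′≤q : All (_≤ q) (c ∷ Q″)
    Q′≤q = from (All≤-shift 1 q (c ∷ Q″)) (subst (All (_≤ suc q)) eqR (Allₚ.++⁻ˡ R′ rest≤))

glued-from-first-1 : ∀ a A′ R → 1 ∉ a ∷ A′ → RAS213 (a ∷ A′ ++ 1 ∷ R) → Glued (a ∷ A′ ++ 1 ∷ R)
glued-from-first-1 a A′ R 1∉A ras@(pos , _ , asc , _)
  with 1-free-then-ones (1 ∷ reverseAcc [ a ] A′) R (here refl) (All.tail (Allₚ.++⁻ʳ (a ∷ A′) pos))
         (proj₂ (proj₂ (to (NewIffAscent-++ [ a ] A′ (1 ∷ R) []) asc)))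
... | R′ , r , refl , 1∉R′ = glued-from-split a A′ R′ r 1∉A 1∉R′ ras

decompose : ∀ x → RAS213 x → x ≡ replicate (length x) 1 ⊎ Glued x
decompose []      (_ , _ , () , _)
decompose (a ∷ y) ras with a ≟ 1 | first-1 (a ∷ y)
... | yes refl | _                               = inj₁ (cong (1 ∷_) (RAS213-head-1 y ras))
... | no  _    | inj₁ 1∉x                        = contradiction (1∈-RAS213 ras) 1∉x
... | no  a≢1  | inj₂ ([] , _ , refl , _)        = contradiction refl a≢1
... | no  _    | inj₂ (b ∷ A′ , R , refl , 1∉A) = inj₂ (glued-from-first-1 b A′ R 1∉A ras)

-- Counting

length-concatMap : ∀ {A B : Set} (F : A → List B) xs → length (concatMap F xs) ≡ foldr _+_ 0 (map (length ∘ F) xs)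
length-concatMap F []       = refl
length-concatMap F (x ∷ xs) = trans (length-++ (F x)) (cong (length (F x) +_) (length-concatMap F xs))

length-cartesianProduct : ∀ {A B : Set} (xs : List A) (ys : List B) →
  length (cartesianProduct xs ys) ≡ length xs * length ys
length-cartesianProduct []       ys = refl
length-cartesianProduct (x ∷ xs) ys =
  trans (length-++ (map (x ,_) ys)) (cong₂ _+_ (length-map (x ,_) ys) (length-cartesianProduct xs ys))

sum-map-*ˡ : ∀ {A : Set} c (g : A → ℕ) xs → foldr _+_ 0 (map (λ x → c * g x) xs) ≡ c * foldr _+_ 0 (map g xs)
sum-map-*ˡ c g []       = sym (*-zeroʳ c)
sum-map-*ˡ c g (x ∷ xs) = trans (cong (c * g x +_) (sum-map-*ˡ c g xs)) (sym (*-distribˡ-+ c (g x) _))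

unique-set-equal⇒length≡ : ∀ {A : Set} {xs ys : List A} → Unique xs → Unique ys → (∀ {x} → x ∈ xs ⇔ x ∈ ys) →
  length xs ≡ length ys
unique-set-equal⇒length≡ uxs uys same = ↭-length (∼bag⇒↭ (unique∧set⇒bag uxs uys same))

≤∸⇔+≤ : ∀ {m} n o → 1 ≤ m → m ≤ o ∸ n ⇔ m + n ≤ o
≤∸⇔+≤ {m} n o 1≤m = mk⇔
  (λ m≤ → m≤o∸n⇒m+n≤o m (<⇒≤ (m∸n≢0⇒n<m λ eq → contradiction (subst (m ≤_) eq m≤) (<⇒≱ 1≤m))) m≤)
  (m+n≤o⇒m≤o∸n m)

∈-upTo-∸ : ∀ a b {d} → d ∈ upTo (suc b ∸ a) ⇔ a + d ≤ b
∈-upTo-∸ a b {d} = mk⇔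
  (λ d∈ → subst (_≤ b) (+-comm d a) (≤-pred (to (≤∸⇔+≤ a (suc b) (s≤s z≤n)) (∈-upTo⁻ d∈))))
  (λ a+d≤b → ∈-upTo⁺ (from (≤∸⇔+≤ a (suc b) (s≤s z≤n)) (s≤s (subst (_≤ b) (+-comm a d) a+d≤b))))

-- The ranges of d and e are copied from sumFromTo, so that length-codes is a plain computation.
blocks : ℕ → ℕ → List (List ℕ × List ℕ)
blocks n k = concatMap (λ e → cartesianProduct (Bhat k pat213) (Bhat (2 + e) pat213)) (upTo (suc (n ∸ k) ∸ 2))

codes : ℕ → List (List ℕ × List ℕ)
codes n = concatMap (λ d → blocks n (1 + d)) (upTo (suc (n ∸ 2) ∸ 1))

length-blocks : ∀ n k → length (blocks n k) ≡ f k * sumFromTo 2 (n ∸ k) (λ j → f j)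
length-blocks n k = begin
  length (blocks n k)
    ≡⟨ length-concatMap (λ e → cartesianProduct (Bhat k pat213) (Bhat (2 + e) pat213)) es ⟩
  foldr _+_ 0 (map (λ e → length (cartesianProduct (Bhat k pat213) (Bhat (2 + e) pat213))) es)
    ≡⟨ cong (foldr _+_ 0) (map-cong (λ e → length-cartesianProduct (Bhat k pat213) (Bhat (2 + e) pat213)) es) ⟩
  foldr _+_ 0 (map (λ e → f k * f (2 + e)) es)
    ≡⟨ sum-map-*ˡ (f k) (λ e → f (2 + e)) es ⟩
  f k * sumFromTo 2 (n ∸ k) (λ j → f j) ∎
  where
  open ≡-Reasoning
  es = upTo (suc (n ∸ k) ∸ 2)

length-codes : ∀ n → length (codes n) ≡ sumFromTo 1 (n ∸ 2) (λ k → f k * sumFromTo 2 (n ∸ k) (λ j → f j))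
length-codes n = trans (length-concatMap (λ d → blocks n (1 + d)) (upTo (n ∸ 2)))
                       (cong (foldr _+_ 0) (map-cong (λ d → length-blocks n (1 + d)) (upTo (n ∸ 2))))

∈-Bhat⇒length : ∀ {n x} → x ∈ Bhat n pat213 → length x ≡ n
∈-Bhat⇒length = proj₂ ∘ to ∈-Bhat

data Code (n : ℕ) : List ℕ × List ℕ → Set where
  code : ∀ {p P′ q c Q″} → RAS213 (p ∷ P′) → RAS213 (q ∷ c ∷ Q″) →
         length (p ∷ P′) + length (q ∷ c ∷ Q″) ≤ n → Code n (p ∷ P′ , q ∷ c ∷ Q″)

∈-codes : ∀ {n PQ} → PQ ∈ codes n ⇔ Code n PQ
∈-codes {n} = mk⇔ out into
  where
  out : ∀ {PQ} → PQ ∈ codes n → Code n PQ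
  out pq∈ with find (∈-concatMap⁻ (λ d → blocks n (1 + d)) {xs = upTo (n ∸ 2)} pq∈)
  ... | d , d∈ , pq∈′ with find (∈-concatMap⁻ (λ e → cartesianProduct (Bhat (1 + d) pat213) (Bhat (2 + e) pat213))
                                              {xs = upTo (suc (n ∸ (1 + d)) ∸ 2)} pq∈′)
  ... | e , e∈ , pq∈″ with ∈-cartesianProduct⁻ (Bhat (1 + d) pat213) (Bhat (2 + e) pat213) pq∈″
  ... | P∈ , Q∈ with to (∈-Bhat {1 + d}) P∈ | to (∈-Bhat {2 + e}) Q∈
  ... | rasP@(_ ∷ _ , _) , refl | rasQ@(_ ∷ _ ∷ _ , _) , refl =
    code rasP rasQ (subst (_≤ n) (+-comm (2 + e) (1 + d)) (to (≤∸⇔+≤ (1 + d) n (s≤s z≤n)) (to (∈-upTo-∸ 2 (n ∸ (1 + d))) e∈)))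
  into : ∀ {PQ} → Code n PQ → PQ ∈ codes n
  into (code {P′ = P′} {Q″ = Q″} rasP rasQ bound) =
    ∈-concatMap⁺ (λ d → blocks n (1 + d)) (lose d∈
      (∈-concatMap⁺ (λ e → cartesianProduct (Bhat k pat213) (Bhat (2 + e) pat213)) (lose e∈
        (∈-cartesianProduct⁺ (from ∈-Bhat (rasP , refl)) (from ∈-Bhat (rasQ , refl))))))
    where
    k = suc (length P′)
    d∈ : length P′ ∈ upTo (n ∸ 2)
    d∈ = from (∈-upTo-∸ 1 (n ∸ 2)) (from (≤∸⇔+≤ 2 n (s≤s z≤n)) (≤-trans (+-monoʳ-≤ k (s≤s (s≤s z≤n))) bound))
    e∈ : length Q″ ∈ upTo (suc (n ∸ k) ∸ 2)
    e∈ = from (∈-upTo-∸ 2 (n ∸ k)) (from (≤∸⇔+≤ k n (s≤s z≤n)) (subst (_≤ n) (+-comm k _) bound))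

codes-unique : ∀ n → Unique (codes n)
codes-unique n = Unique-concatMap (λ d → blocks n (1 + d)) (Uniqueₚ.upTo⁺ (n ∸ 2)) blocks-unique sameFirstLength
  where
  pairs : ℕ → ℕ → List (List ℕ × List ℕ)
  pairs k e = cartesianProduct (Bhat k pat213) (Bhat (2 + e) pat213)
  blocks-unique : ∀ d → Unique (blocks n (1 + d))
  blocks-unique d = Unique-concatMap (pairs (1 + d)) (Uniqueₚ.upTo⁺ (suc (n ∸ suc d) ∸ 2))
    (λ e → Uniqueₚ.cartesianProduct⁺ (Bhat-unique (1 + d)) (Bhat-unique (2 + e)))
    secondLength
    where
    secondLength : ∀ {e e′ z} → z ∈ pairs (1 + d) e → z ∈ pairs (1 + d) e′ → e ≡ e′
    secondLength {e} {e′} z∈ z∈′ = suc-injective (suc-injective (trans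
      (sym (∈-Bhat⇒length (proj₂ (∈-cartesianProduct⁻ (Bhat (1 + d) pat213) (Bhat (2 + e) pat213) z∈))))
      (∈-Bhat⇒length (proj₂ (∈-cartesianProduct⁻ (Bhat (1 + d) pat213) (Bhat (2 + e′) pat213) z∈′)))))
  firstLength : ∀ {k P Q} → (P , Q) ∈ blocks n k → length P ≡ k
  firstLength {k} pq∈ with find (∈-concatMap⁻ (pairs k) {xs = upTo (suc (n ∸ k) ∸ 2)} pq∈)
  ... | e , _ , pq∈′ = ∈-Bhat⇒length (proj₁ (∈-cartesianProduct⁻ (Bhat k pat213) (Bhat (2 + e) pat213) pq∈′))
  sameFirstLength : ∀ {d d′ z} → z ∈ blocks n (1 + d) → z ∈ blocks n (1 + d′) → d ≡ d′
  sameFirstLength {z = P , Q} z∈ z∈′ = suc-injective (trans (sym (firstLength z∈)) (firstLength z∈′))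

glueCode : ℕ → List ℕ × List ℕ → List ℕ
glueCode n (P , Q) = glue P Q (n ∸ (length P + length Q))

candidates : ℕ → List (List ℕ)
candidates n = replicate n 1 ∷ map (glueCode n) (codes n)

RAS213-ones : ∀ m → RAS213 (replicate (suc m) 1)
RAS213-ones m = Allₚ.replicate⁺ (suc m) ≤-refl , cayley , NewIffAscent-ones [ 1 ] m (here refl) , Avoids213-ones (suc m)
  where
  cayley : Cayley (replicate (suc m) 1)
  cayley v 1≤v v≤max with ≤-antisym (≤-trans v≤max (maxL-≤ (replicate (suc m) 1) (Allₚ.replicate⁺ (suc m) ≤-refl))) 1≤v
  ... | refl = here refl

glue-RAS213 : ∀ {p P′ q c Q″} r → RAS213 (p ∷ P′) → RAS213 (q ∷ c ∷ Q″) → RAS213 (glue (p ∷ P′) (q ∷ c ∷ Q″) r)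
glue-RAS213 {p} {P′} {q} {c} {Q″} r rasP rasQ@(Q-pos , _ , ascQ , _) =
  from (Glue.RAS213⇔ p P′ q c Q″ r (proj₁ rasP) (1∈-RAS213 rasP) (All.tail Q-pos) (RevisedAscent⇒head-max q (c ∷ Q″) ascQ))
       (rasP , rasQ)

Glued⇒RAS213-parts : ∀ {x} (g : Glued x) → RAS213 x →
  RAS213 (Glued.p g ∷ Glued.P′ g) × RAS213 (Glued.q g ∷ Glued.c g ∷ Glued.Q″ g)
Glued⇒RAS213-parts (glued p P′ q c Q″ r P-pos 1∈P Q′-pos Q′≤q refl) = to (Glue.RAS213⇔ p P′ q c Q″ r P-pos 1∈P Q′-pos Q′≤q)

glueCode-∈-Bhat : ∀ {n PQ} → Code n PQ → glueCode n PQ ∈ Bhat n pat213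
glueCode-∈-Bhat {n} (code {p} {P′} {q} {c} {Q″} rasP rasQ bound) =
  from ∈-Bhat (glue-RAS213 r rasP rasQ , (begin
    length (glue P Q r)          ≡⟨ length-glue P q (c ∷ Q″) r ⟩
    length P + (length Q + r)    ≡⟨ +-assoc (length P) (length Q) r ⟨
    length P + length Q + r      ≡⟨ m+[n∸m]≡n bound ⟩
    n                            ∎))
  where
  open ≡-Reasoning
  P = p ∷ P′
  Q = q ∷ c ∷ Q″
  r = n ∸ (length P + length Q)

candidate⇒∈-Bhat : ∀ {n x} → 1 ≤ n → x ∈ candidates n → x ∈ Bhat n pat213
candidate⇒∈-Bhat {suc m} _ (here refl) = from ∈-Bhat (RAS213-ones m , length-replicate (suc m))
candidate⇒∈-Bhat {n}     _ (there x∈) with ∈-map⁻ (glueCode n) x∈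
... | PQ , pq∈ , refl = glueCode-∈-Bhat (to ∈-codes pq∈)

∈-Bhat⇒candidate : ∀ {n x} → x ∈ Bhat n pat213 → x ∈ candidates n
∈-Bhat⇒candidate {n} {x} x∈ with to ∈-Bhat x∈
... | ras , len with decompose x ras
... | inj₁ x≡1s = here (trans x≡1s (cong (λ m → replicate m 1) len))
... | inj₂ g@(glued p P′ q c Q″ r _ _ _ _ refl) =
  there (subst (_∈ map (glueCode n) (codes n)) (cong (glue P Q) r≡) (∈-map⁺ (glueCode n) PQ∈))
  where
  P = p ∷ P′
  Q = q ∷ c ∷ Q″
  total : length P + length Q + r ≡ n
  total = trans (+-assoc (length P) (length Q) r) (trans (sym (length-glue P q (c ∷ Q″) r)) len)
  PQ∈ : (P , Q) ∈ codes n
  PQ∈ = from ∈-codes (code (proj₁ (Glued⇒RAS213-parts g ras)) (proj₂ (Glued⇒RAS213-parts g ras))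
                           (subst (length P + length Q ≤_) total (m≤m+n (length P + length Q) r)))
  r≡ : n ∸ (length P + length Q) ≡ r
  r≡ = trans (cong (_∸ (length P + length Q)) (sym total)) (m+n∸m≡n (length P + length Q) r)

Unique-map⁺-on : ∀ {A B : Set} (g : A → B) {xs} → (∀ {x y} → x ∈ xs → y ∈ xs → g x ≡ g y → x ≡ y) →
  Unique xs → Unique (map g xs)
Unique-map⁺-on g {[]}     _   _                   = AllPairs.[]
Unique-map⁺-on g {x ∷ xs} inj (x∉xs AllPairs.∷ u) =
  Allₚ.map⁺ (All.tabulate λ y∈ gx≡gy → All.lookup x∉xs y∈ (inj (here refl) (there y∈) gx≡gy)) AllPairs.∷
  Unique-map⁺-on g (λ x∈ y∈ → inj (there x∈) (there y∈)) u

glueCode-injective : ∀ {n PQ PQ₂} → Code n PQ → Code n PQ₂ → glueCode n PQ ≡ glueCode n PQ₂ → PQ ≡ PQ₂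
glueCode-injective (code rasP@(P-pos , _) (Q-pos , _) _) (code rasP₂@(P₂-pos , _) (Q₂-pos , _) _) eq =
  let eqP , eqQ = glue-injective P-pos (1∈-RAS213 rasP) (All.head Q-pos) (All.tail Q-pos)
                                 P₂-pos (1∈-RAS213 rasP₂) (All.head Q₂-pos) (All.tail Q₂-pos) eq
  in cong₂ _,_ eqP eqQ

glueCode-head≢1 : ∀ {n PQ ys} → Code n PQ → glueCode n PQ ≢ 1 ∷ ys
glueCode-head≢1 (code (p-pos ∷ _ , _) (q-pos ∷ _ , _) _) eq = <⇒≢ (+-mono-≤ q-pos p-pos) (sym (proj₁ (∷-injective eq)))

candidates-unique : ∀ n → 1 ≤ n → Unique (candidates n)
candidates-unique (suc m) _ =
  Allₚ.map⁺ (All.tabulate λ PQ∈ → glueCode-head≢1 (to ∈-codes PQ∈) ∘ sym) AllPairs.∷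
  Unique-map⁺-on (glueCode (suc m)) (λ PQ∈ PQ₂∈ → glueCode-injective (to ∈-codes PQ∈) (to ∈-codes PQ₂∈))
    (codes-unique (suc m))

mainTheorem20 : ∀ (n : ℕ) → 1 ≤ n →
    f n ≡ 1 + sumFromTo 1 (n ∸ 2) (λ k → f k * sumFromTo 2 (n ∸ k) (λ j → f j))
mainTheorem20 n 1≤n = begin
  f n                           ≡⟨ unique-set-equal⇒length≡ (Bhat-unique n) (candidates-unique n 1≤n)
                                     (mk⇔ ∈-Bhat⇒candidate (candidate⇒∈-Bhat 1≤n)) ⟩
  length (candidates n)         ≡⟨ cong suc (length-map (glueCode n) (codes n)) ⟩
  1 + length (codes n)          ≡⟨ cong suc (length-codes n) ⟩
  1 + sumFromTo 1 (n ∸ 2) (λ k → f k * sumFromTo 2 (n ∸ k) (λ j → f j)) ∎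
  where open ≡-Reasoning
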